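{- Let $G=(V,E)$ be a finite graph and $m\ge1$ an integer. Define $f(A)=\sum_{v\in V}m_A(v)$ where $m_A(v)=m$ if [$v\notin A$ and $|N_A(v)|\ge m$] or [$v\in A$ and $|N_A(v)|>0$]; $m_A(v)=m-1$ if $v\in A$ and $|N_A(v)|=0$; and $m_A(v)=|N_A(v)|$ otherwise. Then $f$ is submodular and monotone non-decreasing.
   Context: $N_A(v)=N(v)\cap A$, where $N(v)$ is the set of neighbors of $v$. $f$ is submodular if $f(B\cup\{x\})-f(B)\le f(A\cup\{x\})-f(A)$ for all $A\subseteq B\subseteq V$, $x\in V\setminus B$. -}

module Defs where

open import Data.Nat using (ℕ; zero; suc; _≤_; _<_; _∸_; _+_; _≤?_; _<?_)
open import Data.Fin using (Fin)
open import Data.Fin.Subset using (Subset; Side; inside; outside; _∈_; _∉_; _⊆_; _∩_; _∪_; ⁅_⁆; ∣_∣)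
open import Data.Vec using (lookup; tabulate; sum)
open import Relation.Nullary using (yes; no)

record Graph (n : ℕ) : Set where
  field
    adj   : Fin n → Subset n
    sym   : ∀ u v → u ∈ adj v → v ∈ adj u
    irrefl : ∀ v → v ∉ adj v

open Graph public

N : ∀ {n} → Graph n → Fin n → Subset n
N G v = adj G v

N[_] : ∀ {n} → Graph n → Subset n → Fin n → Subset n
N[ G ] A v = N G v ∩ A

mA : ∀ {n} → Graph n → ℕ → Subset n → Fin n → ℕ
mA G m A v with lookup A v
... | outside with m ≤? ∣ N[ G ] A v ∣
...   | yes _ = m
...   | no  _ = ∣ N[ G ] A v ∣
mA G m A v | inside with 0 <? ∣ N[ G ] A v ∣
...   | yes _ = m
...   | no  _ = m ∸ 1

f : ∀ {n} → Graph n → ℕ → Subset n → ℕ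
f G m A = sum (tabulate (mA G m A))

-- Submodularity: f(B ∪ {x}) - f(B) ≤ f(A ∪ {x}) - f(A) for A ⊆ B, x ∉ B,
-- written additively (values are in ℕ, so we avoid truncated subtraction).
Submodular : ∀ {n} → (Subset n → ℕ) → Set
Submodular {n} g = ∀ (A B : Subset n) (x : Fin n) → A ⊆ B → x ∉ B →
  g (B ∪ ⁅ x ⁆) + g A ≤ g (A ∪ ⁅ x ⁆) + g B

Monotone : ∀ {n} → (Subset n → ℕ) → Set
Monotone {n} g = ∀ (A B : Subset n) → A ⊆ B → g A ≤ g B

-- m_A(v) depends only on whether v ∈ A and on k = |N_A(v)|, through a weight
-- w(s, k) that is monotone in both arguments, whose increment in k is antitone
-- in both arguments (m ⊓ k is concave; inside A the weight saturates at k = 1),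
-- and whose gain from moving inside is antitone in k.  Adding x to A moves x
-- itself inside without changing its count (x ∉ N(x)) and raises by one the
-- count of every neighbour of x; so monotonicity and the submodular inequality
-- hold vertex by vertex, and f inherits them by summation.

module Submission where

open import Algebra.Properties.CommutativeSemigroup using (interchange)
open import Data.Bool using (f≤t; b≤b; _∨_) renaming (_≤_ to _≤ˢ_)
open import Data.Bool.Properties using (∨-identityʳ)
open import Data.Fin using (Fin; zero; suc)
open import Data.Fin.Properties using (_≟_)
open import Data.Fin.Subset using (Subset; Side; inside; outside; _∈_; _∉_; _⊆_; _∩_; _∪_; ⁅_⁆; ∣_∣)
open import Data.Fin.Subset.Properties
  using (_∈?_; ⊆-antisym; p⊆q⇒∣p∣≤∣q∣; x∈p∩q⁺; x∈p∩q⁻; x∈p∪q⁺; x∈p∪q⁻; p⊆p∪q; ∪-identityʳ;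
         x∈⁅x⁆; x∈⁅y⁆⇒x≡y; x≢y⇒x∉⁅y⁆)
open import Data.Nat using (ℕ; zero; suc; _+_; _∸_; _⊓_; _≤_; _<_; _≥_; z≤n; s≤s; _≤?_; _<?_)
open import Data.Nat.Properties
  using (≤-refl; ≤-reflexive; ≤-trans; module ≤-Reasoning; ≰⇒≥; n≤1+n; m≤m+n; m∸n≤m;
         +-comm; +-suc; +-identityʳ; +-mono-≤; +-monoˡ-≤; +-monoʳ-≤; +-commutativeSemigroup;
         ⊓-zeroʳ; ⊓-monoˡ-≤; ⊓-monoʳ-≤; m⊓n≤m; m⊓n≤n; m≤n⇒m⊓n≡m; m≥n⇒m⊓n≡n)
open import Data.Product using (_×_; _,_; proj₂)
open import Data.Sum using (inj₁; inj₂)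
open import Data.Vec using (_∷_; lookup; tabulate; sum; here; there)
open import Data.Vec.Properties using ([]=⇒lookup; lookup⇒[]=; lookup-zipWith)
open import Defs hiding (sym)
open import Function using (_∘_)
open import Relation.Binary.PropositionalEquality
  using (_≡_; _≢_; refl; sym; trans; cong; subst; module ≡-Reasoning)
open import Relation.Nullary using (yes; no; ¬_; contradiction)

lookup-∉ : ∀ {n} {p : Subset n} {x} → x ∉ p → lookup p x ≡ outside
lookup-∉ {p = p} {x} x∉p with lookup p x in eq
... | outside = refl
... | inside  = contradiction (lookup⇒[]= x p eq) x∉p

⊆⇒lookup-≤ : ∀ {n} {p q : Subset n} {x} → p ⊆ q → lookup p x ≤ˢ lookup q x
⊆⇒lookup-≤ {p = p} {q} {x} p⊆q with lookup p x in eqp | lookup q x in eqq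
... | outside | outside = b≤b
... | outside | inside  = f≤t
... | inside  | inside  = b≤b
... | inside  | outside with () ← trans (sym eqq) ([]=⇒lookup (p⊆q (lookup⇒[]= x p eqp)))

lookup-∪⁅x⁆-self : ∀ {n} (p : Subset n) x → lookup (p ∪ ⁅ x ⁆) x ≡ inside
lookup-∪⁅x⁆-self p x = []=⇒lookup (x∈p∪q⁺ {p = p} (inj₂ (x∈⁅x⁆ x)))

lookup-∪⁅x⁆-other : ∀ {n} (p : Subset n) {x y} → y ≢ x → lookup (p ∪ ⁅ x ⁆) y ≡ lookup p y
lookup-∪⁅x⁆-other p {x} {y} y≢x = begin
  lookup (p ∪ ⁅ x ⁆) y          ≡⟨ lookup-zipWith _∨_ y p ⁅ x ⁆ ⟩
  lookup p y ∨ lookup ⁅ x ⁆ y   ≡⟨ cong (lookup p y ∨_) (lookup-∉ (x≢y⇒x∉⁅y⁆ y≢x)) ⟩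
  lookup p y ∨ outside          ≡⟨ ∨-identityʳ _ ⟩
  lookup p y                    ∎
  where open ≡-Reasoning

∩-monoʳ-⊆ : ∀ {n} (p : Subset n) {q r} → q ⊆ r → p ∩ q ⊆ p ∩ r
∩-monoʳ-⊆ p {q} q⊆r y∈p∩q with x∈p∩q⁻ p q y∈p∩q
... | y∈p , y∈q = x∈p∩q⁺ (y∈p , q⊆r y∈q)

p∩[q∪⁅x⁆]≡p∩q : ∀ {n} (p q : Subset n) {x} → x ∉ p → p ∩ (q ∪ ⁅ x ⁆) ≡ p ∩ q
p∩[q∪⁅x⁆]≡p∩q p q {x} x∉p = ⊆-antisym shrink (∩-monoʳ-⊆ p (p⊆p∪q ⁅ x ⁆))
  where
    shrink : p ∩ (q ∪ ⁅ x ⁆) ⊆ p ∩ q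
    shrink y∈ with x∈p∩q⁻ p _ y∈
    ... | y∈p , y∈q∪⁅x⁆ with x∈p∪q⁻ q ⁅ x ⁆ y∈q∪⁅x⁆
    ...   | inj₁ y∈q   = x∈p∩q⁺ (y∈p , y∈q)
    ...   | inj₂ y∈⁅x⁆ = contradiction (subst (_∈ p) (x∈⁅y⁆⇒x≡y x y∈⁅x⁆) y∈p) x∉p

p∩[q∪⁅x⁆]≡[p∩q]∪⁅x⁆ : ∀ {n} (p q : Subset n) {x} → x ∈ p → p ∩ (q ∪ ⁅ x ⁆) ≡ (p ∩ q) ∪ ⁅ x ⁆
p∩[q∪⁅x⁆]≡[p∩q]∪⁅x⁆ p q {x} x∈p = ⊆-antisym shrink grow
  where
    shrink : p ∩ (q ∪ ⁅ x ⁆) ⊆ (p ∩ q) ∪ ⁅ x ⁆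
    shrink y∈ with x∈p∩q⁻ p _ y∈
    ... | y∈p , y∈q∪⁅x⁆ with x∈p∪q⁻ q ⁅ x ⁆ y∈q∪⁅x⁆
    ...   | inj₁ y∈q   = x∈p∪q⁺ (inj₁ (x∈p∩q⁺ (y∈p , y∈q)))
    ...   | inj₂ y∈⁅x⁆ = x∈p∪q⁺ (inj₂ y∈⁅x⁆)
    grow : (p ∩ q) ∪ ⁅ x ⁆ ⊆ p ∩ (q ∪ ⁅ x ⁆)
    grow y∈ with x∈p∪q⁻ (p ∩ q) ⁅ x ⁆ y∈
    ... | inj₁ y∈p∩q = ∩-monoʳ-⊆ p (p⊆p∪q ⁅ x ⁆) y∈p∩q
    ... | inj₂ y∈⁅x⁆ rewrite x∈⁅y⁆⇒x≡y x y∈⁅x⁆ = x∈p∩q⁺ (x∈p , x∈p∪q⁺ (inj₂ (x∈⁅x⁆ x)))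

∣p∪⁅x⁆∣≡1+∣p∣ : ∀ {n} (p : Subset n) {x} → x ∉ p → ∣ p ∪ ⁅ x ⁆ ∣ ≡ suc ∣ p ∣
∣p∪⁅x⁆∣≡1+∣p∣ (outside ∷ p) {zero}  _   = cong (suc ∘ ∣_∣) (∪-identityʳ p)
∣p∪⁅x⁆∣≡1+∣p∣ (inside  ∷ p) {zero}  x∉p = contradiction here x∉p
∣p∪⁅x⁆∣≡1+∣p∣ (outside ∷ p) {suc x} x∉p = ∣p∪⁅x⁆∣≡1+∣p∣ p (x∉p ∘ there)
∣p∪⁅x⁆∣≡1+∣p∣ (inside  ∷ p) {suc x} x∉p = cong suc (∣p∪⁅x⁆∣≡1+∣p∣ p (x∉p ∘ there))

∣p∩[q∪⁅x⁆]∣≡1+∣p∩q∣ : ∀ {n} (p q : Subset n) {x} → x ∈ p → x ∉ q → ∣ p ∩ (q ∪ ⁅ x ⁆) ∣ ≡ suc ∣ p ∩ q ∣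
∣p∩[q∪⁅x⁆]∣≡1+∣p∩q∣ p q x∈p x∉q = begin
  ∣ p ∩ (q ∪ ⁅ _ ⁆) ∣  ≡⟨ cong ∣_∣ (p∩[q∪⁅x⁆]≡[p∩q]∪⁅x⁆ p q x∈p) ⟩
  ∣ (p ∩ q) ∪ ⁅ _ ⁆ ∣  ≡⟨ ∣p∪⁅x⁆∣≡1+∣p∣ (p ∩ q) (x∉q ∘ proj₂ ∘ x∈p∩q⁻ p q) ⟩
  suc ∣ p ∩ q ∣        ∎
  where open ≡-Reasoning

sum-tabulate-mono : ∀ {n} {g h : Fin n → ℕ} → (∀ i → g i ≤ h i) → sum (tabulate g) ≤ sum (tabulate h)
sum-tabulate-mono {zero}  _   = z≤n
sum-tabulate-mono {suc n} g≤h = +-mono-≤ (g≤h zero) (sum-tabulate-mono (g≤h ∘ suc))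

sum-tabulate-+ : ∀ {n} (g h : Fin n → ℕ) →
  sum (tabulate (λ i → g i + h i)) ≡ sum (tabulate g) + sum (tabulate h)
sum-tabulate-+ {zero}  g h = refl
sum-tabulate-+ {suc n} g h = begin
  (g zero + h zero) + sum (tabulate (λ i → g (suc i) + h (suc i)))
    ≡⟨ cong (g zero + h zero +_) (sum-tabulate-+ (g ∘ suc) (h ∘ suc)) ⟩
  (g zero + h zero) + (sum (tabulate (g ∘ suc)) + sum (tabulate (h ∘ suc)))
    ≡⟨ interchange +-commutativeSemigroup (g zero) (h zero) _ _ ⟩
  (g zero + sum (tabulate (g ∘ suc))) + (h zero + sum (tabulate (h ∘ suc)))
    ∎
  where open ≡-Reasoning

sum-tabulate-mono₂ : ∀ {n} {a b c d : Fin n → ℕ} → (∀ i → a i + b i ≤ c i + d i) →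
  sum (tabulate a) + sum (tabulate b) ≤ sum (tabulate c) + sum (tabulate d)
sum-tabulate-mono₂ {a = a} {b} {c} {d} pointwise = begin
  sum (tabulate a) + sum (tabulate b)      ≡⟨ sum-tabulate-+ a b ⟨
  sum (tabulate (λ i → a i + b i))         ≤⟨ sum-tabulate-mono pointwise ⟩
  sum (tabulate (λ i → c i + d i))         ≡⟨ sum-tabulate-+ c d ⟩
  sum (tabulate c) + sum (tabulate d)      ∎
  where open ≤-Reasoning

⊓-increment-antitone : ∀ m {a b} → a ≤ b → m ⊓ suc b + m ⊓ a ≤ m ⊓ suc a + m ⊓ b
⊓-increment-antitone zero          _         = ≤-refl
⊓-increment-antitone (suc m) {zero} {b} _ = begin
  suc (m ⊓ b) + 0      ≡⟨ +-identityʳ _ ⟩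
  suc (m ⊓ b)          ≤⟨ s≤s (⊓-monoˡ-≤ b (n≤1+n m)) ⟩
  suc (suc m ⊓ b)      ≡⟨ cong (λ t → suc (t + suc m ⊓ b)) (⊓-zeroʳ m) ⟨
  suc (m ⊓ 0 + suc m ⊓ b) ∎
  where open ≤-Reasoning
⊓-increment-antitone (suc m) {suc a} {suc b} (s≤s a≤b) = begin
  suc (m ⊓ suc b) + suc (m ⊓ a)   ≡⟨ cong suc (+-suc _ _) ⟩
  suc (suc (m ⊓ suc b + m ⊓ a))   ≤⟨ s≤s (s≤s (⊓-increment-antitone m a≤b)) ⟩
  suc (suc (m ⊓ suc a + m ⊓ b))   ≡⟨ cong suc (+-suc _ _) ⟨
  suc (m ⊓ suc a) + suc (m ⊓ b)   ∎
  where open ≤-Reasoning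

weight : ℕ → Side → ℕ → ℕ
weight m outside k       = m ⊓ k
weight m inside  zero    = m ∸ 1
weight m inside  (suc _) = m

weight-inside-pos : ∀ m {k} → 0 < k → weight m inside k ≡ m
weight-inside-pos m (s≤s z≤n) = refl

weight-inside-zero : ∀ m {k} → ¬ 0 < k → weight m inside k ≡ m ∸ 1
weight-inside-zero m {zero}  _   = refl
weight-inside-zero m {suc k} 0≮k = contradiction (s≤s z≤n) 0≮k

weight-mono : ∀ m {s s′ k k′} → s ≤ˢ s′ → k ≤ k′ → weight m s k ≤ weight m s′ k′
weight-mono m {outside} b≤b k≤k′ = ⊓-monoʳ-≤ m k≤k′
weight-mono m {inside} {k = zero}  {zero}   b≤b _ = ≤-refl
weight-mono m {inside} {k = zero}  {suc _}  b≤b _ = m∸n≤m m 1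
weight-mono m {inside} {k = suc _} {suc _}  b≤b _ = ≤-refl
weight-mono m {k = zero}                    f≤t _ = ≤-trans (m⊓n≤n m 0) z≤n
weight-mono m {k = suc k} {suc _}           f≤t _ = m⊓n≤m m (suc k)

weight-increment-antitone : ∀ m {s s′ k k′} → s ≤ˢ s′ → k ≤ k′ →
  weight m s′ (suc k′) + weight m s k ≤ weight m s (suc k) + weight m s′ k′
weight-increment-antitone m {outside} b≤b k≤k′ = ⊓-increment-antitone m k≤k′
weight-increment-antitone m {inside}  b≤b k≤k′ = +-monoʳ-≤ m (weight-mono m (b≤b {inside}) k≤k′)
weight-increment-antitone zero    {k = zero} {zero}  f≤t _ = ≤-refl
weight-increment-antitone (suc m) {k = zero} {zero}  f≤t _ =
  s≤s (≤-reflexive (trans (+-comm m 0) (cong (_+ m) (sym (⊓-zeroʳ m)))))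
weight-increment-antitone m {k = k} {suc _} f≤t _ = begin
  m + m ⊓ k         ≡⟨ +-comm m _ ⟩
  m ⊓ k + m         ≤⟨ +-monoˡ-≤ m (⊓-monoʳ-≤ m (n≤1+n k)) ⟩
  m ⊓ suc k + m     ∎
  where open ≤-Reasoning

weight-insertion-antitone : ∀ m {k k′} → k ≤ k′ →
  weight m inside k′ + weight m outside k ≤ weight m inside k + weight m outside k′
weight-insertion-antitone m       {zero}  {zero}   _ = ≤-refl
weight-insertion-antitone zero    {zero}  {suc _}  _ = ≤-refl
weight-insertion-antitone (suc m) {zero}  {suc k′} _ = begin
  suc m + 0             ≡⟨ +-identityʳ _ ⟩
  suc m                 ≤⟨ s≤s (m≤m+n m _) ⟩
  suc (m + m ⊓ k′)      ≡⟨ +-suc m _ ⟨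
  m + suc (m ⊓ k′)      ∎
  where open ≤-Reasoning
weight-insertion-antitone m {suc _} {suc _} k≤k′ = +-monoʳ-≤ m (⊓-monoʳ-≤ m k≤k′)

module _ {n} (G : Graph n) (m : ℕ) where

  mA≡weight : ∀ A v → mA G m A v ≡ weight m (lookup A v) ∣ N[ G ] A v ∣
  mA≡weight A v with lookup A v
  ... | outside with m ≤? ∣ N[ G ] A v ∣
  ...   | yes m≤k = sym (m≤n⇒m⊓n≡m m≤k)
  ...   | no  m≰k = sym (m≥n⇒m⊓n≡n (≰⇒≥ m≰k))
  mA≡weight A v | inside with 0 <? ∣ N[ G ] A v ∣
  ...   | yes 0<k = sym (weight-inside-pos m 0<k)
  ...   | no  0≮k = sym (weight-inside-zero m 0≮k)

  ∣N[]∣-mono : ∀ {A B} → A ⊆ B → ∀ v → ∣ N[ G ] A v ∣ ≤ ∣ N[ G ] B v ∣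
  ∣N[]∣-mono A⊆B v = p⊆q⇒∣p∣≤∣q∣ (∩-monoʳ-⊆ (adj G v) A⊆B)

  mA-mono : ∀ {A B} → A ⊆ B → ∀ v → mA G m A v ≤ mA G m B v
  mA-mono {A} {B} A⊆B v rewrite mA≡weight A v | mA≡weight B v =
    weight-mono m (⊆⇒lookup-≤ A⊆B) (∣N[]∣-mono A⊆B v)

  mA-submodular : ∀ {A B x} → A ⊆ B → x ∉ B → ∀ v →
    mA G m (B ∪ ⁅ x ⁆) v + mA G m A v ≤ mA G m (A ∪ ⁅ x ⁆) v + mA G m B v
  mA-submodular {A} {B} {x} A⊆B x∉B v
    rewrite mA≡weight (B ∪ ⁅ x ⁆) v | mA≡weight A v
          | mA≡weight (A ∪ ⁅ x ⁆) v | mA≡weight B v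
    with v ≟ x
  ... | yes refl
    rewrite lookup-∪⁅x⁆-self B v | lookup-∪⁅x⁆-self A v
          | lookup-∉ x∉B | lookup-∉ (x∉B ∘ A⊆B)
          | p∩[q∪⁅x⁆]≡p∩q (adj G v) B (irrefl G v) | p∩[q∪⁅x⁆]≡p∩q (adj G v) A (irrefl G v)
          = weight-insertion-antitone m (∣N[]∣-mono A⊆B v)
  ... | no v≢x rewrite lookup-∪⁅x⁆-other B v≢x | lookup-∪⁅x⁆-other A v≢x with x ∈? adj G v
  ...   | yes x∈Nv
    rewrite ∣p∩[q∪⁅x⁆]∣≡1+∣p∩q∣ (adj G v) B x∈Nv x∉B
          | ∣p∩[q∪⁅x⁆]∣≡1+∣p∩q∣ (adj G v) A x∈Nv (x∉B ∘ A⊆B)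
          = weight-increment-antitone m (⊆⇒lookup-≤ A⊆B) (∣N[]∣-mono A⊆B v)
  ...   | no x∉Nv
    rewrite p∩[q∪⁅x⁆]≡p∩q (adj G v) B x∉Nv | p∩[q∪⁅x⁆]≡p∩q (adj G v) A x∉Nv
          = ≤-reflexive (+-comm (weight m (lookup B v) ∣ N[ G ] B v ∣) _)

lemma7 : ∀ {n} (G : Graph n) (m : ℕ) → m ≥ 1 →
    Submodular (f G m) × Monotone (f G m)
lemma7 G m _ =
  (λ A B x A⊆B x∉B → sum-tabulate-mono₂ (mA-submodular G m A⊆B x∉B)) ,
  (λ A B A⊆B → sum-tabulate-mono (mA-mono G m A⊆B))
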